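{- Let $n$, $b$, $k$ be integers with $3 \leq b \leq (n-1)/2$, $b+k \leq n-2$, $2 \leq k \leq n-5$, $k \neq n/2$, and such that, viewed in $\mathbb{Z}_n$, $b \notin \{ -2k,\, 1-2k,\, -k,\, 1-k,\, k,\, k+1\}$. Suppose the Nest graph $\Gamma = \mathcal{N}(n;1,b,b+k;k)$ is edge-transitive. Then for every $3$-cycle of $\Gamma$ there exists an automorphism of $\Gamma$ cyclically permuting its three vertices.
   Context: For integers $n \geq 4$ and $1 \leq a,b,c,k \leq n-1$ with $k \neq n/2$ and $a,b,c$ pairwise distinct, the Nest graph $\mathcal{N}(n;a,b,c;k)$ is the graph with vertex set $\{u_i : i \in \mathbb{Z}_n\} \cup \{v_i : i \in \mathbb{Z}_n\}$ and edges $u_iu_{i+1}$, $v_iv_{i+k}$, $u_iv_i$, $u_iv_{i+a}$, $u_iv_{i+b}$, $u_iv_{i+c}$ for $i \in \mathbb{Z}_n$ (indices modulo $n$). Edge-transitive means the automorphism group acts transitively on edges. -}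

module Defs where

open import Data.Nat using (ℕ; _+_; _*_; _%_; NonZero)
open import Data.Nat.DivMod using (m%n<n)
open import Data.Fin using (Fin; toℕ; fromℕ<)
open import Data.Product using (_×_; _,_; Σ; ∃-syntax)
open import Data.Sum using (_⊎_)
open import Relation.Binary.PropositionalEquality using (_≡_) renaming (setoid to ≡-setoid)
open import Relation.Nullary using (¬_)
open import Function.Bundles using (Inverse)


addMod : (n : ℕ) .{{_ : NonZero n}} → Fin n → ℕ → Fin n
addMod n i m = fromℕ< (m%n<n (toℕ i + m) n)

data Vertex (n : ℕ) : Set where
  u : Fin n → Vertex n
  v : Fin n → Vertex n

data Gen (n : ℕ) .{{_ : NonZero n}} (a b c k : ℕ) : Vertex n → Vertex n → Set where
  rimU  : ∀ i → Gen n a b c k (u i) (u (addMod n i 1))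
  hubV  : ∀ i → Gen n a b c k (v i) (v (addMod n i k))
  spk0  : ∀ i → Gen n a b c k (u i) (v i)
  spkA  : ∀ i → Gen n a b c k (u i) (v (addMod n i a))
  spkB  : ∀ i → Gen n a b c k (u i) (v (addMod n i b))
  spkC  : ∀ i → Gen n a b c k (u i) (v (addMod n i c))

Adj : (n : ℕ) .{{_ : NonZero n}} (a b c k : ℕ) → Vertex n → Vertex n → Set
Adj n a b c k x y = Gen n a b c k x y ⊎ Gen n a b c k y x

record Automorphism (n : ℕ) .{{_ : NonZero n}} (a b c k : ℕ) : Set where
  field
    perm     : Inverse (≡-setoid (Vertex n)) (≡-setoid (Vertex n))
  to : Vertex n → Vertex n
  to = Inverse.to perm
  field
    preserves : ∀ x y → (Adj n a b c k x y → Adj n a b c k (to x) (to y))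
                      × (Adj n a b c k (to x) (to y) → Adj n a b c k x y)

EdgeTransitive : (n : ℕ) .{{_ : NonZero n}} (a b c k : ℕ) → Set
EdgeTransitive n a b c k =
  ∀ x y x' y' → Adj n a b c k x y → Adj n a b c k x' y' →
  Σ (Automorphism n a b c k) λ σ →
    let f = Automorphism.to σ in
    ((f x ≡ x') × (f y ≡ y')) ⊎ ((f x ≡ y') × (f y ≡ x'))

Triangle : (n : ℕ) .{{_ : NonZero n}} (a b c k : ℕ) → Vertex n → Vertex n → Vertex n → Set
Triangle n a b c k x y z =
  ¬ x ≡ y × ¬ y ≡ z × ¬ x ≡ z ×
  Adj n a b c k x y × Adj n a b c k y z × Adj n a b c k x z

-- An edge-transitive graph in which one edge lies in at most one triangle has this property for every edge,
-- and then every triangle admits a rotation: an automorphism sending the edge xy to yz either rotates the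
-- triangle or swaps x and z, and in the latter case an automorphism sending xy to xz supplies either the
-- complementary transposition or an inverse rotation. In N(n;1,b,b+k;k) the rim edge u₀u₁ has v₁ as its
-- only common neighbour, since the spoke offsets {0, 1, b, b+k} meet their translates by 1 only in 1.
module Submission where

open import Defs
open import Data.Nat using (ℕ; _+_; _*_; _∸_; _%_; _≤_; NonZero)
open import Data.Product using (_×_; Σ)
open import Relation.Binary.PropositionalEquality using (_≡_)
open import Relation.Nullary using (¬_)

open import Data.Nat using (suc; _<_; z≤n; s≤s; z<s; >-nonZero⁻¹)
open import Data.Nat.Properties
open import Data.Nat.DivMod using (m%n<n; m%n%n≡m%n; %-distribˡ-+; [m+kn]%n≡m%n; [m+n]%n≡m%n; m<n⇒m%n≡m; n%n≡0)
open import Data.Nat.Tactic.RingSolver using (solve-∀)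
open import Data.Fin using (Fin; toℕ; fromℕ<)
open import Data.Fin.Properties using (toℕ-injective; toℕ-fromℕ<; toℕ<n)
open import Data.Product using (_,_; proj₁; proj₂)
open import Data.Sum using (inj₁; inj₂; swap)
open import Function using (_∘_)
open import Function.Bundles using (Inverse)
import Function.Construct.Composition as Composition
open import Relation.Binary.PropositionalEquality using (_≢_; refl; sym; trans; cong; subst; module ≡-Reasoning)
open import Relation.Nullary using (contradiction)

[m%n+o]%n≡[m+o]%n : ∀ m o n .{{_ : NonZero n}} → (m % n + o) % n ≡ (m + o) % n
[m%n+o]%n≡[m+o]%n m o n = begin
  (m % n + o) % n           ≡⟨ %-distribˡ-+ (m % n) o n ⟩
  (m % n % n + o % n) % n   ≡⟨ cong (λ x → (x + o % n) % n) (m%n%n≡m%n m n) ⟩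
  (m % n + o % n) % n       ≡⟨ %-distribˡ-+ m o n ⟨
  (m + o) % n               ∎
  where open ≡-Reasoning

%-cancelˡ-+ : ∀ m {a c} n .{{_ : NonZero n}} → (m + a) % n ≡ (m + c) % n → a % n ≡ c % n
%-cancelˡ-+ m {a} {c} n@(suc p) eq = begin
  a % n                           ≡⟨ [m+kn]%n≡m%n a m n ⟨
  (a + m * n) % n                 ≡⟨ cong (_% n) (shift a m p) ⟩
  (p * m + (m + a)) % n           ≡⟨ %-distribˡ-+ (p * m) (m + a) n ⟩
  (p * m % n + (m + a) % n) % n   ≡⟨ cong (λ x → (p * m % n + x) % n) eq ⟩
  (p * m % n + (m + c) % n) % n   ≡⟨ %-distribˡ-+ (p * m) (m + c) n ⟨
  (p * m + (m + c)) % n           ≡⟨ cong (_% n) (shift c m p) ⟨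
  (c + m * n) % n                 ≡⟨ [m+kn]%n≡m%n c m n ⟩
  c % n                           ∎
  where
  open ≡-Reasoning
  shift : ∀ x m p → x + m * suc p ≡ p * m + (m + x)
  shift = solve-∀

%-injective-< : ∀ {m o n} .{{_ : NonZero n}} → m < n → o < n → m % n ≡ o % n → m ≡ o
%-injective-< m<n o<n eq = trans (sym (m<n⇒m%n≡m m<n)) (trans eq (m<n⇒m%n≡m o<n))

m≤o∸n⇒n+m≤o : ∀ {m n o} → 0 < m → m ≤ o ∸ n → n + m ≤ o
m≤o∸n⇒n+m≤o {m} {n} {o} 0<m m≤o∸n =
  subst (_≤ o) (+-comm m n) (m≤o∸n⇒m+n≤o m n≤o m≤o∸n)
  where
  n≤o : n ≤ o
  n≤o = <⇒≤ (m∸n≢0⇒n<m (λ o∸n≡0 → <⇒≱ 0<m (subst (m ≤_) o∸n≡0 m≤o∸n)))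

module ModularShift (n : ℕ) .{{_ : NonZero n}} where

  infixl 6 _⊕_
  _⊕_ : Fin n → ℕ → Fin n
  i ⊕ m = addMod n i m

  toℕ-⊕ : ∀ i m → toℕ (i ⊕ m) ≡ (toℕ i + m) % n
  toℕ-⊕ i m = toℕ-fromℕ< (m%n<n (toℕ i + m) n)

  ⊕-assoc : ∀ i m o → i ⊕ m ⊕ o ≡ i ⊕ (m + o)
  ⊕-assoc i m o = toℕ-injective (begin
    toℕ (i ⊕ m ⊕ o)             ≡⟨ toℕ-⊕ (i ⊕ m) o ⟩
    (toℕ (i ⊕ m) + o) % n       ≡⟨ cong (λ x → (x + o) % n) (toℕ-⊕ i m) ⟩
    ((toℕ i + m) % n + o) % n   ≡⟨ [m%n+o]%n≡[m+o]%n (toℕ i + m) o n ⟩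
    (toℕ i + m + o) % n         ≡⟨ cong (_% n) (+-assoc (toℕ i) m o) ⟩
    (toℕ i + (m + o)) % n       ≡⟨ toℕ-⊕ i (m + o) ⟨
    toℕ (i ⊕ (m + o))           ∎)
    where open ≡-Reasoning

  ⊕-identityʳ : ∀ i → i ⊕ 0 ≡ i
  ⊕-identityʳ i = toℕ-injective (begin
    toℕ (i ⊕ 0)          ≡⟨ toℕ-⊕ i 0 ⟩
    (toℕ i + 0) % n      ≡⟨ cong (_% n) (+-identityʳ (toℕ i)) ⟩
    toℕ i % n            ≡⟨ m<n⇒m%n≡m (toℕ<n i) ⟩
    toℕ i                ∎)
    where open ≡-Reasoning

  ⊕-period : ∀ i → i ⊕ n ≡ i
  ⊕-period i = toℕ-injective (begin
    toℕ (i ⊕ n)          ≡⟨ toℕ-⊕ i n ⟩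
    (toℕ i + n) % n      ≡⟨ [m+n]%n≡m%n (toℕ i) n ⟩
    toℕ i % n            ≡⟨ m<n⇒m%n≡m (toℕ<n i) ⟩
    toℕ i                ∎)
    where open ≡-Reasoning

  ⊕-1-⊕-pred : ∀ i → i ⊕ 1 ⊕ (n ∸ 1) ≡ i
  ⊕-1-⊕-pred i = begin
    i ⊕ 1 ⊕ (n ∸ 1)      ≡⟨ ⊕-assoc i 1 (n ∸ 1) ⟩
    i ⊕ (1 + (n ∸ 1))    ≡⟨ cong (i ⊕_) (m+[n∸m]≡n (>-nonZero⁻¹ n)) ⟩
    i ⊕ n                ≡⟨ ⊕-period i ⟩
    i                    ∎
    where open ≡-Reasoning

  ⊕-cancelˡ : ∀ i {m o} → i ⊕ m ≡ i ⊕ o → m % n ≡ o % n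
  ⊕-cancelˡ i {m} {o} eq =
    %-cancelˡ-+ (toℕ i) n (trans (sym (toℕ-⊕ i m)) (trans (cong toℕ eq) (toℕ-⊕ i o)))

module NestGraph (n : ℕ) .{{_ : NonZero n}} (a b c k : ℕ) where

  infix 4 _~_
  _~_ : Vertex n → Vertex n → Set
  _~_ = Adj n a b c k

  ~-sym : ∀ {x y} → x ~ y → y ~ x
  ~-sym = swap

  Aut : Set
  Aut = Automorphism n a b c k

  open Automorphism using (to; perm; preserves)

  from : Aut → Vertex n → Vertex n
  from σ = Inverse.from (perm σ)

  to-from : (σ : Aut) → ∀ w → to σ (from σ w) ≡ w
  to-from σ = Inverse.strictlyInverseˡ (perm σ)

  preserves-~ : (σ : Aut) → ∀ {x y} → x ~ y → to σ x ~ to σ y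
  preserves-~ σ {x} {y} = proj₁ (preserves σ x y)

  reflects-~ : (σ : Aut) → ∀ {x w} → to σ x ~ w → x ~ from σ w
  reflects-~ σ {x} {w} σx~w = proj₂ (preserves σ x (from σ w)) (subst (to σ x ~_) (sym (to-from σ w)) σx~w)

  infixr 9 _∘ᴬ_
  _∘ᴬ_ : Aut → Aut → Aut
  τ ∘ᴬ σ = record
    { perm      = Composition.inverse (perm σ) (perm τ)
    ; preserves = λ x y →
        proj₁ (preserves τ (to σ x) (to σ y)) ∘ proj₁ (preserves σ x y) ,
        proj₂ (preserves σ x y) ∘ proj₂ (preserves τ (to σ x) (to σ y))
    }

  AtMostOneCommonNeighbour : Vertex n → Vertex n → Set
  AtMostOneCommonNeighbour x y = ∀ {w w'} → x ~ w → y ~ w → x ~ w' → y ~ w' → w ≡ w'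

  atMostOneCommonNeighbour-sym : ∀ {x y} → AtMostOneCommonNeighbour x y → AtMostOneCommonNeighbour y x
  atMostOneCommonNeighbour-sym unique y~w x~w y~w' x~w' = unique x~w y~w x~w' y~w'

  atMostOneCommonNeighbour-image : (σ : Aut) → ∀ {x y} →
    AtMostOneCommonNeighbour x y → AtMostOneCommonNeighbour (to σ x) (to σ y)
  atMostOneCommonNeighbour-image σ unique {w} {w'} σx~w σy~w σx~w' σy~w' = begin
    w                 ≡⟨ to-from σ w ⟨
    to σ (from σ w)   ≡⟨ cong (to σ) (unique (reflects-~ σ σx~w) (reflects-~ σ σy~w)
                                              (reflects-~ σ σx~w') (reflects-~ σ σy~w')) ⟩
    to σ (from σ w')  ≡⟨ to-from σ w' ⟩
    w'                ∎
    where open ≡-Reasoning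

  atMostOneCommonNeighbour-everywhere : EdgeTransitive n a b c k →
    ∀ {x y} → x ~ y → AtMostOneCommonNeighbour x y →
    ∀ {x' y'} → x' ~ y' → AtMostOneCommonNeighbour x' y'
  atMostOneCommonNeighbour-everywhere edgeTransitive {x} {y} x~y unique {x'} {y'} x'~y'
    with edgeTransitive x y x' y' x~y x'~y'
  ... | σ , inj₁ (refl , refl) = atMostOneCommonNeighbour-image σ unique
  ... | σ , inj₂ (refl , refl) = atMostOneCommonNeighbour-sym (atMostOneCommonNeighbour-image σ unique)

  image-of-third-vertex : (σ : Aut) → ∀ {x y z x' y' z'} → to σ x ≡ x' → to σ y ≡ y' →
    AtMostOneCommonNeighbour x' y' → x ~ z → y ~ z → x' ~ z' → y' ~ z' → to σ z ≡ z'
  image-of-third-vertex σ refl refl unique x~z y~z = unique (preserves-~ σ x~z) (preserves-~ σ y~z)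

  triangle-rotation : EdgeTransitive n a b c k →
    (∀ {x y} → x ~ y → AtMostOneCommonNeighbour x y) →
    ∀ {x y z} → Triangle n a b c k x y z →
    Σ Aut λ ρ → (to ρ x ≡ y) × (to ρ y ≡ z) × (to ρ z ≡ x)
  triangle-rotation edgeTransitive unique {x} {y} {z} (_ , _ , _ , x~y , y~z , x~z)
    with edgeTransitive x y y z x~y y~z
  ... | σ , inj₁ (σx≡y , σy≡z) = σ , σx≡y , σy≡z , σz≡x
    where
    σz≡x : to σ z ≡ x
    σz≡x = image-of-third-vertex σ σx≡y σy≡z (unique y~z) x~z y~z (~-sym x~y) (~-sym x~z)
  ... | σ , inj₂ (σx≡z , σy≡y) with edgeTransitive x y x z x~y x~z
  ... | τ , inj₁ (τx≡x , τy≡z) =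
    τ ∘ᴬ σ ,
    trans (cong (to τ) σx≡z) τz≡y ,
    trans (cong (to τ) σy≡y) τy≡z ,
    trans (cong (to τ) σz≡x) τx≡x
    where
    σz≡x : to σ z ≡ x
    σz≡x = image-of-third-vertex σ σx≡z σy≡y (unique (~-sym y~z)) x~z y~z (~-sym x~z) (~-sym x~y)
    τz≡y : to τ z ≡ y
    τz≡y = image-of-third-vertex τ τx≡x τy≡z (unique x~z) x~z y~z x~y (~-sym y~z)
  ... | τ , inj₂ (τx≡z , τy≡x) =
    τ ∘ᴬ τ ,
    trans (cong (to τ) τx≡z) τz≡y ,
    trans (cong (to τ) τy≡x) τx≡z ,
    trans (cong (to τ) τz≡y) τy≡x
    where
    τz≡y : to τ z ≡ y
    τz≡y = image-of-third-vertex τ τx≡z τy≡x (unique (~-sym x~z)) x~z y~z (~-sym y~z) x~y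

module RimEdges (n : ℕ) .{{_ : NonZero n}} (b c k : ℕ) where

  open ModularShift n
  open NestGraph n 1 b c k using (AtMostOneCommonNeighbour)

  data RimOffset : ℕ → Set where
    forward  : RimOffset 1
    backward : RimOffset (n ∸ 1)

  data SpokeOffset : ℕ → Set where
    offset-0 : SpokeOffset 0
    offset-1 : SpokeOffset 1
    offset-b : SpokeOffset b
    offset-c : SpokeOffset c

  data NeighbourOfU (i : Fin n) : Vertex n → Set where
    rim   : ∀ {d j} → RimOffset d → j ≡ i ⊕ d → NeighbourOfU i (u j)
    spoke : ∀ {d j} → SpokeOffset d → j ≡ i ⊕ d → NeighbourOfU i (v j)

  neighbourOfU : ∀ {i w} → Adj n 1 b c k (u i) w → NeighbourOfU i w
  neighbourOfU (inj₁ (rimU i)) = rim forward refl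
  neighbourOfU (inj₁ (spk0 i)) = spoke offset-0 (sym (⊕-identityʳ i))
  neighbourOfU (inj₁ (spkA i)) = spoke offset-1 refl
  neighbourOfU (inj₁ (spkB i)) = spoke offset-b refl
  neighbourOfU (inj₁ (spkC i)) = spoke offset-c refl
  neighbourOfU (inj₂ (rimU j)) = rim backward (sym (⊕-1-⊕-pred j))

  shifted-offsets : ∀ {i j d d'} → j ≡ i ⊕ d → j ≡ i ⊕ 1 ⊕ d' → d % n ≡ suc d' % n
  shifted-offsets {i} {d' = d'} refl j≡i⊕1⊕d' = ⊕-cancelˡ i (trans j≡i⊕1⊕d' (⊕-assoc i 1 d'))

  module _ (3≤b : 3 ≤ b) (2+b≤c : 2 + b ≤ c) (2+c≤n : 2 + c ≤ n) where

    private
      2<b : 2 < b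
      2<b = 3≤b
      1<b : 1 < b
      1<b = <-trans (n<1+n 1) 2<b
      b≤c : b ≤ c
      b≤c = ≤-trans (m≤n+m b 2) 2+b≤c
      2<c : 2 < c
      2<c = <-≤-trans 2<b b≤c
      1<c : 1 < c
      1<c = <-trans (n<1+n 1) 2<c
      7≤n : 7 ≤ n
      7≤n = ≤-trans (+-monoʳ-≤ 2 (≤-trans (+-monoʳ-≤ 2 3≤b) 2+b≤c)) 2+c≤n
      2<n : 2 < n
      2<n = ≤-trans (m≤m+n 3 4) 7≤n
      1<n : 1 < n
      1<n = <-trans (n<1+n 1) 2<n
      2<n∸1 : 2 < n ∸ 1
      2<n∸1 = m+n≤o⇒m≤o∸n 3 (≤-trans (m≤m+n 4 3) 7≤n)
      n∸1<n : n ∸ 1 < n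
      n∸1<n = ∸-monoʳ-< (n<1+n 0) (>-nonZero⁻¹ n)
      [1+[n∸1]]%n≡0 : suc (n ∸ 1) % n ≡ 0
      [1+[n∸1]]%n≡0 = trans (cong (_% n) (m+[n∸m]≡n (>-nonZero⁻¹ n))) (n%n≡0 n)

    spokeOffset<n : ∀ {d} → SpokeOffset d → suc d < n
    spokeOffset<n s = ≤-trans (s≤s (s≤s (spokeOffset≤c s))) 2+c≤n
      where
      spokeOffset≤c : ∀ {d} → SpokeOffset d → d ≤ c
      spokeOffset≤c offset-0 = z≤n
      spokeOffset≤c offset-1 = <⇒≤ 1<c
      spokeOffset≤c offset-b = b≤c
      spokeOffset≤c offset-c = ≤-refl

    spokeOffsets-shifted : ∀ {d d'} → SpokeOffset d → SpokeOffset d' → d ≡ suc d' → d ≡ 1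
    spokeOffsets-shifted offset-0 _        ()
    spokeOffsets-shifted offset-1 _        _   = refl
    spokeOffsets-shifted offset-b offset-0 b≡1 = contradiction b≡1 (>⇒≢ 1<b)
    spokeOffsets-shifted offset-b offset-1 b≡2 = contradiction b≡2 (>⇒≢ 2<b)
    spokeOffsets-shifted offset-b offset-b b≡b+1 = contradiction (sym b≡b+1) 1+n≢n
    spokeOffsets-shifted offset-b offset-c b≡c+1 = contradiction b≡c+1 (<⇒≢ (s≤s b≤c))
    spokeOffsets-shifted offset-c offset-0 c≡1 = contradiction c≡1 (>⇒≢ 1<c)
    spokeOffsets-shifted offset-c offset-1 c≡2 = contradiction c≡2 (>⇒≢ 2<c)
    spokeOffsets-shifted offset-c offset-b c≡b+1 = contradiction c≡b+1 (>⇒≢ 2+b≤c)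
    spokeOffsets-shifted offset-c offset-c c≡c+1 = contradiction (sym c≡c+1) 1+n≢n

    rimOffsets-not-shifted : ∀ {d d'} → RimOffset d → RimOffset d' → d % n ≢ suc d' % n
    rimOffsets-not-shifted forward  forward  eq = contradiction (%-injective-< 1<n 2<n eq) λ ()
    rimOffsets-not-shifted forward  backward eq =
      contradiction (trans (sym (m<n⇒m%n≡m 1<n)) (trans eq [1+[n∸1]]%n≡0)) λ ()
    rimOffsets-not-shifted backward forward  eq = contradiction (%-injective-< n∸1<n 2<n eq) (>⇒≢ 2<n∸1)
    rimOffsets-not-shifted backward backward eq =
      contradiction (trans (sym (m<n⇒m%n≡m n∸1<n)) (trans eq [1+[n∸1]]%n≡0)) (>⇒≢ (<-trans z<s 2<n∸1))

    rim-edge-common-neighbour : ∀ {i w} → NeighbourOfU i w → NeighbourOfU (i ⊕ 1) w → w ≡ v (i ⊕ 1)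
    rim-edge-common-neighbour (rim r e) (rim r' e') = contradiction (shifted-offsets e e') (rimOffsets-not-shifted r r')
    rim-edge-common-neighbour {i} (spoke {d} s e) (spoke {d'} s' e') =
      cong v (trans e (cong (i ⊕_) (spokeOffsets-shifted s s' d≡1+d')))
      where
      d≡1+d' : d ≡ suc d'
      d≡1+d' = %-injective-< (<-trans (n<1+n _) (spokeOffset<n s)) (spokeOffset<n s') (shifted-offsets e e')

    rim-edge-atMostOneCommonNeighbour : ∀ i → AtMostOneCommonNeighbour (u i) (u (i ⊕ 1))
    rim-edge-atMostOneCommonNeighbour i ui~w ui⊕1~w ui~w' ui⊕1~w' =
      trans (rim-edge-common-neighbour (neighbourOfU ui~w) (neighbourOfU ui⊕1~w))
            (sym (rim-edge-common-neighbour (neighbourOfU ui~w') (neighbourOfU ui⊕1~w')))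

lemma4p7 : (n b k : ℕ) .{{_ : NonZero n}} →
    3 ≤ b → 2 * b ≤ n ∸ 1 → b + k ≤ n ∸ 2 → 2 ≤ k → k ≤ n ∸ 5 → ¬ (2 * k ≡ n) →
    ¬ ((b + 2 * k) % n ≡ 0) → ¬ ((b + 2 * k) % n ≡ 1) →
    ¬ ((b + k) % n ≡ 0) → ¬ ((b + k) % n ≡ 1) →
    ¬ (b % n ≡ k % n) → ¬ (b % n ≡ (k + 1) % n) →
    EdgeTransitive n 1 b (b + k) k →
    ∀ x y z → Triangle n 1 b (b + k) k x y z →
    Σ (Automorphism n 1 b (b + k) k) λ σ →
      (Automorphism.to σ x ≡ y) × (Automorphism.to σ y ≡ z) × (Automorphism.to σ z ≡ x)
lemma4p7 n b k 3≤b _ b+k≤n∸2 2≤k _ _ _ _ _ _ _ _ edgeTransitive x y z triangle =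
  triangle-rotation edgeTransitive
    (atMostOneCommonNeighbour-everywhere edgeTransitive (inj₁ (rimU i₀)) rim-edge-i₀-unique)
    triangle
  where
  open NestGraph n 1 b (b + k) k
  open RimEdges n b (b + k) k
  i₀ : Fin n
  i₀ = fromℕ< (>-nonZero⁻¹ n)
  2+b≤b+k : 2 + b ≤ b + k
  2+b≤b+k = ≤-trans (≤-reflexive (+-comm 2 b)) (+-monoʳ-≤ b 2≤k)
  2+b+k≤n : 2 + (b + k) ≤ n
  2+b+k≤n = m≤o∸n⇒n+m≤o (<-≤-trans z<s (≤-trans 3≤b (m≤m+n b k))) b+k≤n∸2
  rim-edge-i₀-unique : AtMostOneCommonNeighbour (u i₀) (u (addMod n i₀ 1))
  rim-edge-i₀-unique = rim-edge-atMostOneCommonNeighbour 3≤b 2+b≤b+k 2+b+k≤n i₀
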